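{- Let $C=C_0(d)$ for a fixed integer $d\ge1$, let $\tau$ be an integer, and let $\delta>0$ be a sufficiently small constant. There is a sufficiently small constant $\epsilon=\epsilon(\delta)>0$ such that the following holds. Suppose $|C|^{(1-\epsilon)n}\le M\le|C|^{(1+\epsilon)n}$ and $\pi=(\pi_w)_{w\in C}$ is a solution profile with $\pi_0\ge(\frac{1}{|C|}+\delta)n$. Then with probability at least $1-e^{ -\Omega(n)}$, $\vec{\bm x}$ drawn uniformly from $[0:M-1]^n$ has no solution under the profile $\pi$.
   Context: $[a:b]=\{a,\dots,b\}$, $C_0(d)=\{0,\pm1,\dots,\pm d\}$. A solution profile is a tuple $\pi=(\pi_w)_{w\in C}$ of nonnegative integers summing to $n$. A vector $\vec c\in C^n$ is a solution under $\pi$ for $\vec x$ and target $\tau$ if $\vec c\cdot\vec x=\tau$, $\vec c$ has exactly $\pi_w$ coordinates equal to $w$ for each $w\in C$, and $\vec c\ne\vec 0$ when $\tau=0$.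
   Formalization: The sufficiently small constant δ ranges only over the positive rationals. -}

module Defs where

open import Data.Nat as ℕ using (ℕ; zero; suc; _≤_; _<_; _^_)
open import Data.Integer as ℤ using (ℤ; +_; ∣_∣)
open import Data.Integer.Properties using () renaming (_≟_ to _≟ℤ_)
open import Data.Fin using (Fin; toℕ)
open import Data.List as List using (List; upTo)
open import Data.Vec as Vec using (Vec; []; _∷_)
open import Data.Vec.Relation.Unary.All using (All)
open import Data.Product using (_×_; ∃)
open import Data.Nat.ListAction using (sum)
open import Relation.Nullary using (¬_; yes; no)
open import Relation.Binary.PropositionalEquality using (_≡_)

Clist : ℕ → List ℤ
Clist d = List.map (λ i → (+ i) ℤ.- (+ d)) (upTo (suc (2 ℕ.* d)))

card : ℕ → ℕ
card d = suc (2 ℕ.* d)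

InC : ℕ → ℤ → Set
InC d w = ∣ w ∣ ≤ d

countEq : ∀ {n} → ℤ → Vec ℤ n → ℕ
countEq w [] = 0
countEq w (c ∷ cs) with c ≟ℤ w
... | yes _ = suc (countEq w cs)
... | no  _ = countEq w cs

dot : ∀ {n} → Vec ℤ n → Vec ℕ n → ℤ
dot [] [] = + 0
dot (c ∷ cs) (x ∷ xs) = c ℤ.* (+ x) ℤ.+ dot cs xs

-- π : ℤ → ℕ is a solution profile over C₀(d) of length n
-- (only the values on C₀(d) matter)
IsProfile : ℕ → ℕ → (ℤ → ℕ) → Set
IsProfile d n π = sum (List.map π (Clist d)) ≡ n

IsSolution : ∀ {n} → ℕ → (ℤ → ℕ) → ℤ → Vec ℕ n → Vec ℤ n → Set
IsSolution {n} d π τ x c =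
  All (InC d) c
  × dot c x ≡ τ
  × (∀ w → InC d w → countEq w c ≡ π w)
  × (τ ≡ + 0 → ¬ (c ≡ Vec.replicate n (+ 0)))

HasSolution : ∀ {n} → ℕ → (ℤ → ℕ) → ℤ → Vec ℕ n → Set
HasSolution {n} d π τ x = ∃ λ (c : Vec ℤ n) → IsSolution d π τ x c

toNatVec : ∀ {M n} → Vec (Fin M) n → Vec ℕ n
toNatVec = Vec.map toℕ

module Submission where

-- A vector x admits a solution under π only if some nonzero c ∈ Cⁿ with exactly K = π₀
-- zero coordinates has c · x = τ; for a fixed c, the coordinate of x at the first nonzero
-- entry of c is determined by the others, so c accounts for at most M^(n-1) vectors.
-- Weighting each coefficient vector by u per zero and v per nonzero coordinate, all of Cⁿ
-- weighs (u + 2d v)ⁿ, so there are at most (u + 2d v)ⁿ / (u^K v^(n-K)) relevant c.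
-- Write δ = p/q, R = q|C|, m = q + p|C| (so m/R = 1/|C| + δ and m n ≤ K R), and take
-- u = (V+1)^R, v = V^R for a large V.  Then u^K v^(n-K) ≥ αⁿ with α = (V+1)^m V^(R-m),
-- and Bernoulli's inequality gives P := u + 2d v < |C| α because m/R > 1/|C|.  Hence the
-- bad vectors form a fraction at most (P / (|C| α))ⁿ |C|ⁿ / M of [0:M-1]ⁿ, which is
-- exponentially small once M ≥ |C|^((1-ε)n) with ε small compared to 1 - P/(|C| α).

open import Defs
open import Data.Nat using (ℕ; _≤_; _<_; _+_; _*_; _∸_; _^_)
open import Data.Integer using (ℤ; +_)
open import Data.Fin using (Fin)
open import Data.List using (List; length)
open import Data.List.Membership.Propositional using (_∈_)
open import Data.Vec using (Vec)
open import Data.Product using (_×_; ∃; Σ)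

open import Data.Nat using (zero; suc; z≤n; s≤s; NonZero; >-nonZero; _≟_; _≤?_; _<?_)
open import Data.Nat.Properties
open import Data.Nat.DivMod using (_/_; m*n/n≡m)
open import Data.Nat.Tactic.RingSolver using (solve-∀)
open import Data.Integer as ℤ using (-[1+_]; ∣_∣; _-_)
import Data.Integer.Properties as ℤ
open import Algebra.Properties.AbelianGroup ℤ.+-0-abelianGroup using (xyx⁻¹≈y)
open import Data.Fin using (toℕ; fromℕ<)
open import Data.Fin.Properties using (toℕ-injective; toℕ-fromℕ<; toℕ<n)
open import Data.List using ([]; _∷_; _++_; [_]; map; concatMap; allFin)
open import Data.List.Properties using (length-++; length-map; length-tabulate)
open import Data.List.Relation.Unary.Any using (here; there)
open import Data.List.Membership.Propositional.Properties
  using (∈-map⁺; ∈-++⁺ˡ; ∈-++⁺ʳ; ∈-concat⁺′; ∈-allFin)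
open import Data.Vec using ([]; _∷_; replicate)
import Data.Vec.Properties as Vec
open import Data.Vec.Relation.Unary.All using (All; []; _∷_)
open import Data.Product using (_,_)
open import Data.Empty using (⊥-elim)
open import Function using (_∘_; id)
open import Relation.Nullary using (Dec; yes; no)
open import Relation.Binary.PropositionalEquality
  using (_≡_; _≢_; refl; sym; trans; cong; cong₂; subst; module ≡-Reasoning)

branch : ∀ {A : Set} {n} → (A → List (Vec A n)) → List A → List (Vec A (suc n))
branch f = concatMap (λ x → map (x ∷_) (f x))

∈-branch : ∀ {A : Set} {n} (f : A → List (Vec A n)) {x xs ys} →
           x ∈ xs → ys ∈ f x → (x ∷ ys) ∈ branch f xs
∈-branch f x∈xs ys∈fx = ∈-concat⁺′ (∈-map⁺ _ ys∈fx) (∈-map⁺ _ x∈xs)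

length-concatMap-≤ : ∀ {A B : Set} (f : A → List B) {k} xs →
                     (∀ x → length (f x) ≤ k) → length (concatMap f xs) ≤ length xs * k
length-concatMap-≤ f [] _ = z≤n
length-concatMap-≤ f {k} (x ∷ xs) bound = begin
  length (f x ++ concatMap f xs)          ≡⟨ length-++ (f x) ⟩
  length (f x) + length (concatMap f xs)  ≤⟨ +-mono-≤ (bound x) (length-concatMap-≤ f xs bound) ⟩
  k + length xs * k                       ∎
  where open ≤-Reasoning

length-branch : ∀ {A : Set} {n} (f : A → List (Vec A n)) {k} xs →
                (∀ x → length (f x) ≤ k) → length (branch f xs) ≤ length xs * k
length-branch f xs bound =
  length-concatMap-≤ _ xs (λ x → ≤-trans (≤-reflexive (length-map (x ∷_) (f x))) (bound x))

nonzeroCoeffs : ℕ → List ℤ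
nonzeroCoeffs zero = []
nonzeroCoeffs (suc k) = + suc k ∷ -[1+ k ] ∷ nonzeroCoeffs k

∈-nonzeroCoeffs : ∀ d {w} → InC d w → w ≢ + 0 → w ∈ nonzeroCoeffs d
∈-nonzeroCoeffs d {+ zero} _ w≢0 = ⊥-elim (w≢0 refl)
∈-nonzeroCoeffs (suc k) {+ suc j} (s≤s j≤k) _ with j ≟ k
... | yes refl = here refl
... | no j≢k = there (there (∈-nonzeroCoeffs k (≤∧≢⇒< j≤k j≢k) λ ()))
∈-nonzeroCoeffs (suc k) { -[1+ j ]} (s≤s j≤k) _ with j ≟ k
... | yes refl = there (here refl)
... | no j≢k = there (there (∈-nonzeroCoeffs k (≤∧≢⇒< j≤k j≢k) λ ()))

length-nonzeroCoeffs : ∀ d → length (nonzeroCoeffs d) ≡ 2 * d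
length-nonzeroCoeffs zero = refl
length-nonzeroCoeffs (suc k) =
  cong suc (trans (cong suc (length-nonzeroCoeffs k)) (sym (+-suc k (k + 0))))

countEq-replicate : ∀ n → countEq (+ 0) (replicate n (+ 0)) ≡ n
countEq-replicate zero = refl
countEq-replicate (suc n) = cong suc (countEq-replicate n)

dot-replicate : ∀ {n} (x : Vec ℕ n) → dot (replicate n (+ 0)) x ≡ + 0
dot-replicate [] = refl
dot-replicate (x ∷ xs) = trans (ℤ.+-identityˡ _) (dot-replicate xs)

∣c*x∣/∣c∣≡x : ∀ c x .{{_ : NonZero ∣ c ∣}} → ∣ c ℤ.* + x ∣ / ∣ c ∣ ≡ x
∣c*x∣/∣c∣≡x c x = begin
  ∣ c ℤ.* + x ∣ / ∣ c ∣   ≡⟨ cong (_/ ∣ c ∣) (trans (ℤ.abs-* c (+ x)) (*-comm ∣ c ∣ x)) ⟩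
  x * ∣ c ∣ / ∣ c ∣       ≡⟨ m*n/n≡m x ∣ c ∣ ⟩
  x                       ∎
  where open ≡-Reasoning

^-distrib-* : ∀ x y n → (x * y) ^ n ≡ x ^ n * y ^ n
^-distrib-* x y zero = refl
^-distrib-* x y (suc n) = trans (cong (x * y *_) (^-distrib-* x y n)) (interchange x y (x ^ n) (y ^ n))
  where
  interchange : ∀ x y a b → x * y * (a * b) ≡ x * a * (y * b)
  interchange = solve-∀

^-comm : ∀ x m n → (x ^ m) ^ n ≡ (x ^ n) ^ m
^-comm x m n = trans (^-*-assoc x m n) (trans (cong (x ^_) (*-comm m n)) (sym (^-*-assoc x n m)))

^-cancelʳ-≤ : ∀ E {x y} → 0 < E → x ^ E ≤ y ^ E → x ≤ y
^-cancelʳ-≤ E@(suc _) {x} {y} _ xᴱ≤yᴱ with x ≤? y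
... | yes x≤y = x≤y
... | no x≰y = ⊥-elim (<⇒≱ (^-monoˡ-< E (≰⇒> x≰y)) xᴱ≤yᴱ)

bernoulli : ∀ V m → V ^ m * (V + m) ≤ V * suc V ^ m
bernoulli V zero = ≤-reflexive (trans (*-identityˡ (V + 0)) (trans (+-identityʳ V) (sym (*-identityʳ V))))
bernoulli V (suc m) = begin
  V * V ^ m * (V + suc m)        ≡⟨ e₁ V (V ^ m) m ⟩
  V ^ m * (V * (V + suc m))      ≤⟨ *-monoʳ-≤ (V ^ m) (m≤m+n _ m) ⟩
  V ^ m * (V * (V + suc m) + m)  ≡⟨ e₂ V (V ^ m) m ⟩
  suc V * (V ^ m * (V + m))      ≤⟨ *-monoʳ-≤ (suc V) (bernoulli V m) ⟩
  suc V * (V * suc V ^ m)        ≡⟨ e₃ V (suc V ^ m) ⟩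
  V * (suc V * suc V ^ m)        ∎
  where
  open ≤-Reasoning
  e₁ : ∀ V x m → V * x * (V + suc m) ≡ x * (V * (V + suc m))
  e₁ = solve-∀
  e₂ : ∀ V x m → x * (V * (V + suc m) + m) ≡ suc V * (x * (V + m))
  e₂ = solve-∀
  e₃ : ∀ V y → suc V * (V * y) ≡ V * (suc V * y)
  e₃ = solve-∀

bernoulli-reverse : ∀ y k s → k + s ≡ y → suc y ^ k * s ≤ y * y ^ k
bernoulli-reverse y zero s refl = ≤-reflexive (trans (*-identityˡ s) (sym (*-identityʳ s)))
bernoulli-reverse y (suc k) s k+1+s≡y = *-cancelʳ-≤ _ _ (suc s) (begin
  suc y * suc y ^ k * s * suc s    ≡⟨ e₁ (suc y) (suc y ^ k) s (suc s) ⟩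
  suc y ^ k * suc s * (suc y * s)  ≤⟨ *-monoˡ-≤ (suc y * s) IH ⟩
  y * y ^ k * (suc y * s)          ≤⟨ *-monoʳ-≤ (y * y ^ k) (+-monoˡ-≤ (y * s) s≤y) ⟩
  y * y ^ k * (y + y * s)          ≡⟨ cong (y * y ^ k *_) (*-suc y s) ⟨
  y * y ^ k * (y * suc s)          ≡⟨ e₂ y (y ^ k) y (suc s) ⟩
  y * (y * y ^ k) * suc s          ∎)
  where
  open ≤-Reasoning
  IH : suc y ^ k * suc s ≤ y * y ^ k
  IH = bernoulli-reverse y k (suc s) (trans (+-suc k s) k+1+s≡y)
  s≤y : s ≤ y
  s≤y = subst (s ≤_) k+1+s≡y (m≤n+m s (suc k))
  e₁ : ∀ a b c d → a * b * c * d ≡ (b * d) * (a * c)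
  e₁ = solve-∀
  e₂ : ∀ a b c d → a * b * (c * d) ≡ c * (a * b) * d
  e₂ = solve-∀

mixedPower-dominates : ∀ D R m s → m ≤ R → R < suc D * m → R * R < s →
  suc (R + s) ^ R + D * (R + s) ^ R < suc D * (suc (R + s) ^ m * (R + s) ^ (R ∸ m))
mixedPower-dominates D R m s m≤R R<[D+1]m R²<s = *-cancelʳ-< (s * V) _ _ (begin-strict
  (U ^ R + D * V ^ R) * (s * V)  ≤⟨ reverse-step ⟩
  V ^ R * X                      <⟨ *-monoʳ-< (V ^ R) {{m^n≢0 V R}} X<Y ⟩
  V ^ R * Y                      ≤⟨ bernoulli-step ⟩
  suc D * (U ^ m * V ^ (R ∸ m)) * (s * V) ∎)
  where
  open ≤-Reasoning
  V U X Y : ℕ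
  V = R + s
  U = suc V
  X = V * (V + D * s)
  Y = suc D * s * (V + m)
  instance
    V≢0 : NonZero V
    V≢0 = >-nonZero (≤-trans (s≤s z≤n) (≤-trans R²<s (m≤n+m s R)))

  reverse-step : (U ^ R + D * V ^ R) * (s * V) ≤ V ^ R * X
  reverse-step = begin
    (U ^ R + D * V ^ R) * (s * V)       ≡⟨ e₁ (U ^ R) s V D (V ^ R) ⟩
    U ^ R * s * V + D * V ^ R * s * V   ≤⟨ +-monoˡ-≤ _ (*-monoˡ-≤ V (bernoulli-reverse V R s refl)) ⟩
    V * V ^ R * V + D * V ^ R * s * V   ≡⟨ e₂ s V D (V ^ R) ⟩
    V ^ R * X                           ∎
    where
    e₁ : ∀ a s V D b → (a + D * b) * (s * V) ≡ a * s * V + D * b * s * V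
    e₁ = solve-∀
    e₂ : ∀ s V D b → V * b * V + D * b * s * V ≡ b * (V * (V + D * s))
    e₂ = solve-∀

  -- (R + s)² < s (R + s) + s (R + 1) is exactly R² < s.
  X<Y : X < Y
  X<Y = begin-strict
    X                                        ≡⟨ e₁ R s D ⟩
    R * R + (2 * R * s + s * s + D * s * V)  <⟨ +-monoˡ-< _ R²<s ⟩
    s + (2 * R * s + s * s + D * s * V)      ≡⟨ e₂ R s D ⟩
    s * suc R + suc D * s * V                ≤⟨ +-monoˡ-≤ _ (*-monoʳ-≤ s R<[D+1]m) ⟩
    s * (suc D * m) + suc D * s * V          ≡⟨ e₃ R s D m ⟩
    Y                                        ∎
    where
    e₁ : ∀ R s D → (R + s) * ((R + s) + D * s) ≡ R * R + (2 * R * s + s * s + D * s * (R + s))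
    e₁ = solve-∀
    e₂ : ∀ R s D → s + (2 * R * s + s * s + D * s * (R + s)) ≡ s * suc R + suc D * s * (R + s)
    e₂ = solve-∀
    e₃ : ∀ R s D m → s * (suc D * m) + suc D * s * (R + s) ≡ suc D * s * ((R + s) + m)
    e₃ = solve-∀

  bernoulli-step : V ^ R * Y ≤ suc D * (U ^ m * V ^ (R ∸ m)) * (s * V)
  bernoulli-step = begin
    V ^ R * Y                                          ≡⟨ cong (_* Y) V^R≡V^m*V^[R∸m] ⟩
    V ^ m * V ^ (R ∸ m) * Y                            ≡⟨ e₁ (V ^ m) (V ^ (R ∸ m)) (suc D) s V m ⟩
    suc D * s * V ^ (R ∸ m) * (V ^ m * (V + m))        ≤⟨ *-monoʳ-≤ (suc D * s * V ^ (R ∸ m)) (bernoulli V m) ⟩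
    suc D * s * V ^ (R ∸ m) * (V * U ^ m)              ≡⟨ e₂ (V ^ (R ∸ m)) (suc D) s V (U ^ m) ⟩
    suc D * (U ^ m * V ^ (R ∸ m)) * (s * V)            ∎
    where
    V^R≡V^m*V^[R∸m] : V ^ R ≡ V ^ m * V ^ (R ∸ m)
    V^R≡V^m*V^[R∸m] = trans (cong (V ^_) (sym (m+[n∸m]≡n m≤R))) (^-distribˡ-+-* V m (R ∸ m))
    e₁ : ∀ A B c s V m → A * B * (c * s * (V + m)) ≡ c * s * B * (A * (V + m))
    e₁ = solve-∀
    e₂ : ∀ B c s V C → c * s * B * (V * C) ≡ c * (C * B) * (s * V)
    e₂ = solve-∀

mixedPower-^-≤ : ∀ U V R m n K → V ≤ U → m ≤ R → K ≤ n → m * n ≤ K * R →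
  (U ^ m * V ^ (R ∸ m)) ^ n ≤ (U ^ R) ^ K * (V ^ R) ^ (n ∸ K)
mixedPower-^-≤ U V R m n K V≤U m≤R K≤n mn≤KR = begin
  (U ^ m * V ^ (R ∸ m)) ^ n                 ≡⟨ split ⟩
  U ^ (m * n) * (V ^ t * V ^ (R * (n ∸ K))) ≤⟨ *-monoʳ-≤ (U ^ (m * n)) (*-monoˡ-≤ _ (^-monoˡ-≤ t V≤U)) ⟩
  U ^ (m * n) * (U ^ t * V ^ (R * (n ∸ K))) ≡⟨ merge ⟩
  (U ^ R) ^ K * (V ^ R) ^ (n ∸ K)           ∎
  where
  open ≤-Reasoning
  t : ℕ
  t = K * R ∸ m * n
  mn+t≡KR : m * n + t ≡ K * R
  mn+t≡KR = m+[n∸m]≡n mn≤KR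
  exponents : (R ∸ m) * n ≡ t + R * (n ∸ K)
  exponents = +-cancelˡ-≡ (m * n) _ _ (begin-equality
    m * n + (R ∸ m) * n        ≡⟨ *-distribʳ-+ n m (R ∸ m) ⟨
    (m + (R ∸ m)) * n          ≡⟨ cong (_* n) (m+[n∸m]≡n m≤R) ⟩
    R * n                      ≡⟨ cong (R *_) (m+[n∸m]≡n K≤n) ⟨
    R * (K + (n ∸ K))          ≡⟨ *-distribˡ-+ R K (n ∸ K) ⟩
    R * K + R * (n ∸ K)        ≡⟨ cong (_+ R * (n ∸ K)) (trans (*-comm R K) (sym mn+t≡KR)) ⟩
    m * n + t + R * (n ∸ K)    ≡⟨ +-assoc (m * n) t (R * (n ∸ K)) ⟩
    m * n + (t + R * (n ∸ K))  ∎)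
  split : (U ^ m * V ^ (R ∸ m)) ^ n ≡ U ^ (m * n) * (V ^ t * V ^ (R * (n ∸ K)))
  split = trans (^-distrib-* (U ^ m) (V ^ (R ∸ m)) n) (cong₂ _*_ (^-*-assoc U m n)
            (trans (^-*-assoc V (R ∸ m) n) (trans (cong (V ^_) exponents) (^-distribˡ-+-* V t _))))
  merge : U ^ (m * n) * (U ^ t * V ^ (R * (n ∸ K))) ≡ (U ^ R) ^ K * (V ^ R) ^ (n ∸ K)
  merge = trans (sym (*-assoc (U ^ (m * n)) (U ^ t) _))
            (cong₂ _*_ (trans (sym (^-distribˡ-+-* U (m * n) t))
                         (trans (cong (U ^_) (trans mn+t≡KR (*-comm K R))) (sym (^-*-assoc U R K))))
                       (sym (^-*-assoc V R (n ∸ K))))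

bernoulli-power : ∀ A c → 0 < A → A ^ (A * c) * c ≤ suc A ^ (A * c)
bernoulli-power A c A>0 = *-cancelˡ-≤ A {{>-nonZero A>0}} (begin
  A * (A ^ (A * c) * c)              ≤⟨ m≤m+n _ _ ⟩
  A * (A ^ (A * c) * c) + A ^ (A * c) * A ≡⟨ e (A ^ (A * c)) A c ⟨
  A ^ (A * c) * (A + A * c)          ≤⟨ bernoulli A (A * c) ⟩
  A * suc A ^ (A * c)                ∎)
  where
  open ≤-Reasoning
  e : ∀ x A c → x * (A + A * c) ≡ A * (x * c) + x * A
  e = solve-∀

base-nonZero : ∀ {x y E} → 0 < E → 0 < x → x ≤ y ^ E → NonZero y
base-nonZero {y = suc _} _ _ _ = _
base-nonZero {y = zero} {E = suc _} _ x>0 x≤0 = ⊥-elim (<⇒≱ x>0 x≤0)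

module DecayRate (c P α : ℕ) (c>0 : 0 < c) (P>0 : 0 < P) (P<cα : P < c * α) where

  E a b : ℕ
  E = 2 * P * c
  a = suc (2 * P)
  b = suc a

  2P>0 : 0 < 2 * P
  2P>0 = ≤-trans (s≤s z≤n) (*-monoʳ-≤ 2 P>0)

  E>0 : 0 < E
  E>0 = *-mono-≤ 2P>0 c>0

  -- Since b P = 2P (P + 1), this is Bernoulli's c (2P)^E ≤ (2P + 1)^E times P + 1 ≤ c α.
  [bP]^E≤cᴱ⁻¹[aα]^E : (b * P) ^ E ≤ c ^ (E ∸ 1) * (a * α) ^ E
  [bP]^E≤cᴱ⁻¹[aα]^E = *-cancelˡ-≤ c {{>-nonZero c>0}} (begin
    c * (b * P) ^ E                  ≡⟨ cong (λ x → c * x ^ E) (bP≡2P[P+1] P) ⟩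
    c * (2 * P * suc P) ^ E          ≡⟨ cong (c *_) (^-distrib-* (2 * P) (suc P) E) ⟩
    c * ((2 * P) ^ E * suc P ^ E)    ≡⟨ e₁ c ((2 * P) ^ E) (suc P ^ E) ⟩
    (2 * P) ^ E * c * suc P ^ E      ≤⟨ *-monoˡ-≤ (suc P ^ E) (bernoulli-power (2 * P) c 2P>0) ⟩
    a ^ E * suc P ^ E                ≤⟨ *-monoʳ-≤ (a ^ E) (^-monoˡ-≤ E P<cα) ⟩
    a ^ E * (c * α) ^ E              ≡⟨ cong (a ^ E *_) (^-distrib-* c α E) ⟩
    a ^ E * (c ^ E * α ^ E)          ≡⟨ e₂ (a ^ E) (c ^ E) (α ^ E) ⟩
    c ^ E * (a ^ E * α ^ E)          ≡⟨ cong (c ^ E *_) (^-distrib-* a α E) ⟨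
    c ^ E * (a * α) ^ E              ≡⟨ cong (λ k → c ^ k * (a * α) ^ E) (m+[n∸m]≡n E>0) ⟨
    c * c ^ (E ∸ 1) * (a * α) ^ E    ≡⟨ *-assoc c (c ^ (E ∸ 1)) _ ⟩
    c * (c ^ (E ∸ 1) * (a * α) ^ E)  ∎)
    where
    open ≤-Reasoning
    bP≡2P[P+1] : ∀ P → suc (suc (2 * P)) * P ≡ 2 * P * suc P
    bP≡2P[P+1] = solve-∀
    e₁ : ∀ c x y → c * (x * y) ≡ x * c * y
    e₁ = solve-∀
    e₂ : ∀ x y z → x * (y * z) ≡ y * (x * z)
    e₂ = solve-∀

  [bP]ⁿ≤M[aα]ⁿ : ∀ M n → c ^ ((E ∸ 1) * n) ≤ M ^ E → (b * P) ^ n ≤ M * (a * α) ^ n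
  [bP]ⁿ≤M[aα]ⁿ M n cᴱ⁻¹ⁿ≤Mᴱ = ^-cancelʳ-≤ E E>0 (begin
    ((b * P) ^ n) ^ E                       ≡⟨ ^-comm (b * P) n E ⟩
    ((b * P) ^ E) ^ n                       ≤⟨ ^-monoˡ-≤ n [bP]^E≤cᴱ⁻¹[aα]^E ⟩
    (c ^ (E ∸ 1) * (a * α) ^ E) ^ n         ≡⟨ ^-distrib-* (c ^ (E ∸ 1)) _ n ⟩
    (c ^ (E ∸ 1)) ^ n * ((a * α) ^ E) ^ n   ≡⟨ cong₂ _*_ (^-*-assoc c (E ∸ 1) n) (^-comm (a * α) E n) ⟩
    c ^ ((E ∸ 1) * n) * ((a * α) ^ n) ^ E   ≤⟨ *-monoˡ-≤ _ cᴱ⁻¹ⁿ≤Mᴱ ⟩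
    M ^ E * ((a * α) ^ n) ^ E               ≡⟨ ^-distrib-* M _ E ⟨
    (M * (a * α) ^ n) ^ E                   ∎)
    where open ≤-Reasoning

  decay : ∀ M n ℓ → c ^ ((E ∸ 1) * n) ≤ M ^ E → M * ℓ * α ^ n ≤ P ^ n * M ^ n →
          b ^ n * ℓ ≤ a ^ n * M ^ n
  decay M n ℓ cᴱ⁻¹ⁿ≤Mᴱ Mℓαⁿ≤PⁿMⁿ = *-cancelʳ-≤ _ _ (M * α ^ n) (begin
    b ^ n * ℓ * (M * α ^ n)        ≡⟨ e₁ (b ^ n) ℓ M (α ^ n) ⟩
    b ^ n * (M * ℓ * α ^ n)        ≤⟨ *-monoʳ-≤ (b ^ n) Mℓαⁿ≤PⁿMⁿ ⟩
    b ^ n * (P ^ n * M ^ n)        ≡⟨ *-assoc (b ^ n) (P ^ n) (M ^ n) ⟨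
    b ^ n * P ^ n * M ^ n          ≡⟨ cong (_* M ^ n) (^-distrib-* b P n) ⟨
    (b * P) ^ n * M ^ n            ≤⟨ *-monoˡ-≤ (M ^ n) ([bP]ⁿ≤M[aα]ⁿ M n cᴱ⁻¹ⁿ≤Mᴱ) ⟩
    M * (a * α) ^ n * M ^ n        ≡⟨ cong (λ x → M * x * M ^ n) (^-distrib-* a α n) ⟩
    M * (a ^ n * α ^ n) * M ^ n    ≡⟨ e₂ M (a ^ n) (α ^ n) (M ^ n) ⟩
    a ^ n * M ^ n * (M * α ^ n)    ∎)
    where
    open ≤-Reasoning
    instance
      M≢0 : NonZero M
      M≢0 = base-nonZero E>0 (m^n>0 c {{>-nonZero c>0}} ((E ∸ 1) * n)) cᴱ⁻¹ⁿ≤Mᴱ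
      α≢0 : NonZero α
      α≢0 = m*n≢0⇒n≢0 c {{>-nonZero (≤-trans (s≤s z≤n) P<cα)}}
      αⁿ≢0 : NonZero (α ^ n)
      αⁿ≢0 = m^n≢0 α n
      Mαⁿ≢0 : NonZero (M * α ^ n)
      Mαⁿ≢0 = m*n≢0 M (α ^ n)
    e₁ : ∀ x ℓ M y → x * ℓ * (M * y) ≡ x * (M * ℓ * y)
    e₁ = solve-∀
    e₂ : ∀ M x y z → M * (x * y) * z ≡ x * z * (M * y)
    e₂ = solve-∀

module CoverSize (M D : ℕ) where

  soleNonzeroSize : ℕ → ℕ → ℕ
  soleNonzeroSize n K with K ≟ n
  ... | yes _ = M ^ n
  ... | no _ = 0

  mutual
    coverSize : ℕ → ℕ → ℕ
    coverSize zero K = 0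
    coverSize (suc n) K = leadingZeroSize n K + D * (M * coverSize n K + soleNonzeroSize n K)

    leadingZeroSize : ℕ → ℕ → ℕ
    leadingZeroSize n zero = 0
    leadingZeroSize n (suc K) = M * coverSize n K

  soleNonzeroSize-≢ : ∀ {n K} → K ≢ n → soleNonzeroSize n K ≡ 0
  soleNonzeroSize-≢ {n} {K} K≢n with K ≟ n
  ... | yes K≡n = ⊥-elim (K≢n K≡n)
  ... | no _ = refl

  coverSize-vanishes : ∀ {n K} → n ≤ K → coverSize n K ≡ 0
  coverSize-vanishes {zero} _ = refl
  coverSize-vanishes {suc n} {suc K} (s≤s n≤K)
    rewrite coverSize-vanishes n≤K
          | coverSize-vanishes (m≤n⇒m≤1+n n≤K)
          | soleNonzeroSize-≢ (λ K+1≡n → <⇒≱ (subst (_≤ K) (sym K+1≡n) n≤K) ≤-refl)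
          | *-zeroʳ M | *-zeroʳ D = refl

  module Weighted (u v : ℕ) where

    weight : ℕ → ℕ → ℕ
    weight n K = u ^ K * v ^ (n ∸ K)

    zeroTerm total : ℕ → ℕ
    zeroTerm n = u ^ n * M ^ n
    total n = (u + D * v) ^ n * M ^ n

    zeroTerm≤total : ∀ n → zeroTerm n ≤ total n
    zeroTerm≤total n = *-monoˡ-≤ (M ^ n) (^-monoˡ-≤ n (m≤m+n u (D * v)))

    extend : ∀ n X Z → X + zeroTerm n ≤ total n → Z ≤ total n →
             u * M * X + D * v * M * Z + zeroTerm (suc n) ≤ total (suc n)
    extend n X Z X+zero≤total Z≤total = begin
      u * M * X + D * v * M * Z + zeroTerm (suc n) ≡⟨ regroup u M D v X Z (u ^ n) (M ^ n) ⟩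
      u * M * (X + zeroTerm n) + D * v * M * Z     ≤⟨ +-mono-≤ (*-monoʳ-≤ (u * M) X+zero≤total)
                                                                (*-monoʳ-≤ (D * v * M) Z≤total) ⟩
      u * M * total n + D * v * M * total n        ≡⟨ factor u M D v ((u + D * v) ^ n) (M ^ n) ⟩
      total (suc n)                                ∎
      where
      open ≤-Reasoning
      regroup : ∀ u M D v X Z uⁿ Mⁿ →
        u * M * X + D * v * M * Z + u * uⁿ * (M * Mⁿ) ≡ u * M * (X + uⁿ * Mⁿ) + D * v * M * Z
      regroup = solve-∀
      factor : ∀ u M D v Wⁿ Mⁿ →
        u * M * (Wⁿ * Mⁿ) + D * v * M * (Wⁿ * Mⁿ) ≡ (u + D * v) * Wⁿ * (M * Mⁿ)
      factor = solve-∀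

    sole-bound : ∀ n K → M * coverSize n K * weight n K + zeroTerm n ≤ total n →
                 (M * coverSize n K + soleNonzeroSize n K) * weight n K ≤ total n
    sole-bound n K bound with K ≟ n
    ... | yes refl rewrite coverSize-vanishes {K} ≤-refl | n∸n≡0 K | *-zeroʳ M | *-identityʳ (u ^ K) =
      ≤-trans (≤-reflexive (*-comm (M ^ K) (u ^ K))) (zeroTerm≤total K)
    ... | no _ rewrite +-identityʳ (M * coverSize n K) = ≤-trans (m≤m+n _ (zeroTerm n)) bound

    -- Every c ∈ C₀(d)ⁿ weighs u^#zeros v^#nonzeros, together (u + D v)ⁿ; the zero
    -- vector, which cover omits, contributes zeroTerm n.
    coverSize-weighted : ∀ n K → M * coverSize n K * weight n K + zeroTerm n ≤ total n
    coverSize-weighted zero K rewrite *-zeroʳ M = ≤-refl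
    coverSize-weighted (suc n) zero = begin
      M * (D * Z) * (1 * (v * v ^ n)) + zeroTerm (suc n)          ≡⟨ cong (_+ zeroTerm (suc n)) (regroup u M D v Z (v ^ n)) ⟩
      u * M * 0 + D * v * M * (Z * weight n 0) + zeroTerm (suc n) ≤⟨ extend n 0 _ (zeroTerm≤total n)
                                                                             (sole-bound n 0 (coverSize-weighted n 0)) ⟩
      total (suc n)                                               ∎
      where
      open ≤-Reasoning
      Z : ℕ
      Z = M * coverSize n 0 + soleNonzeroSize n 0
      regroup : ∀ u M D v Z vⁿ → M * (D * Z) * (1 * (v * vⁿ)) ≡ u * M * 0 + D * v * M * (Z * (1 * vⁿ))
      regroup = solve-∀
    coverSize-weighted (suc n) (suc K) with suc K ≤? n
    ... | no K≮n rewrite coverSize-vanishes {suc n} {suc K} (≰⇒> K≮n) | *-zeroʳ M =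
      zeroTerm≤total (suc n)
    ... | yes K<n = begin
      M * (M * X + D * Z) * (u * u ^ K * v ^ (n ∸ K)) + zeroTerm (suc n)
        ≡⟨ cong (λ t → M * (M * X + D * Z) * (u * u ^ K * t) + zeroTerm (suc n)) v^[n∸K] ⟩
      M * (M * X + D * Z) * (u * u ^ K * (v * v ^ (n ∸ suc K))) + zeroTerm (suc n)
        ≡⟨ cong (_+ zeroTerm (suc n)) (regroup u M D v X Z (u ^ K) (v ^ (n ∸ suc K))) ⟩
      u * M * (M * X * (u ^ K * (v * v ^ (n ∸ suc K)))) + D * v * M * (Z * weight n (suc K)) + zeroTerm (suc n)
        ≤⟨ extend n _ _ IH (sole-bound n (suc K) (coverSize-weighted n (suc K))) ⟩
      total (suc n) ∎
      where
      open ≤-Reasoning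
      X Z : ℕ
      X = coverSize n K
      Z = M * coverSize n (suc K) + soleNonzeroSize n (suc K)
      v^[n∸K] : v ^ (n ∸ K) ≡ v * v ^ (n ∸ suc K)
      v^[n∸K] = cong (v ^_) (+-∸-assoc 1 K<n)
      IH : M * X * (u ^ K * (v * v ^ (n ∸ suc K))) + zeroTerm n ≤ total n
      IH = subst (λ t → M * X * (u ^ K * t) + zeroTerm n ≤ total n) v^[n∸K] (coverSize-weighted n K)
      regroup : ∀ u M D v X Z uᴷ r →
        M * (M * X + D * Z) * (u * uᴷ * (v * r)) ≡ u * M * (M * X * (uᴷ * (v * r))) + D * v * M * (Z * (u * uᴷ * r))
      regroup = solve-∀

module Cover (d M : ℕ) where

  allVecs : (n : ℕ) → List (Vec (Fin M) n)
  allVecs zero = [ [] ]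
  allVecs (suc n) = branch (λ _ → allVecs n) (allFin M)

  ∈-allVecs : ∀ {n} (x : Vec (Fin M) n) → x ∈ allVecs n
  ∈-allVecs [] = here refl
  ∈-allVecs (x₀ ∷ xs) = ∈-branch _ (∈-allFin x₀) (∈-allVecs xs)

  fromℕ? : ℕ → List (Fin M)
  fromℕ? y with y <? M
  ... | yes y<M = [ fromℕ< y<M ]
  ... | no _ = []

  ∈-fromℕ? : ∀ (x : Fin M) {y} → toℕ x ≡ y → x ∈ fromℕ? y
  ∈-fromℕ? x {y} refl with y <? M
  ... | yes y<M = here (toℕ-injective (sym (toℕ-fromℕ< y<M)))
  ... | no y≮M = ⊥-elim (y≮M (toℕ<n x))

  roots : ℤ → ℤ → List (Fin M)
  roots (+ zero) τ = []
  roots c@(+ suc _) τ = fromℕ? (∣ τ ∣ / ∣ c ∣)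
  roots c@(-[1+ _ ]) τ = fromℕ? (∣ τ ∣ / ∣ c ∣)

  ∈-roots : ∀ {c τ} (x : Fin M) → c ≢ + 0 → c ℤ.* + toℕ x ≡ τ → x ∈ roots c τ
  ∈-roots {+ zero} x c≢0 _ = ⊥-elim (c≢0 refl)
  ∈-roots {c@(+ suc _)} x _ refl = ∈-fromℕ? x (sym (∣c*x∣/∣c∣≡x c (toℕ x)))
  ∈-roots {c@(-[1+ _ ])} x _ refl = ∈-fromℕ? x (sym (∣c*x∣/∣c∣≡x c (toℕ x)))

  soleNonzero : ∀ n → ℕ → ℤ → ℤ → List (Vec (Fin M) (suc n))
  soleNonzero n K τ c₀ with K ≟ n
  ... | yes _ = branch (λ _ → allVecs n) (roots c₀ τ)
  ... | no _ = []

  ∈-soleNonzero : ∀ {n K τ c₀ x₀} (xs : Vec (Fin M) n) →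
                  K ≡ n → x₀ ∈ roots c₀ τ → (x₀ ∷ xs) ∈ soleNonzero n K τ c₀
  ∈-soleNonzero {n} {K} xs K≡n x₀∈roots with K ≟ n
  ... | yes _ = ∈-branch _ x₀∈roots (∈-allVecs xs)
  ... | no K≢n = ⊥-elim (K≢n K≡n)

  -- cover n K τ contains every x with c · x = τ for some nonzero c ∈ C₀(d)ⁿ having exactly
  -- K zero coordinates; it branches on the first coefficient c₀ of c.
  mutual
    cover : (n : ℕ) → ℕ → ℤ → List (Vec (Fin M) n)
    cover zero K τ = []
    cover (suc n) K τ = leadingZero n K τ ++ concatMap (leadingNonzero n K τ) (nonzeroCoeffs d)

    leadingZero : ∀ n → ℕ → ℤ → List (Vec (Fin M) (suc n))
    leadingZero n zero τ = []
    leadingZero n (suc K) τ = branch (λ _ → cover n K τ) (allFin M)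

    leadingNonzero : ∀ n → ℕ → ℤ → ℤ → List (Vec (Fin M) (suc n))
    leadingNonzero n K τ c₀ =
      branch (λ x₀ → cover n K (τ - c₀ ℤ.* + toℕ x₀)) (allFin M) ++ soleNonzero n K τ c₀

  cover-complete : ∀ {n} (c : Vec ℤ n) (x : Vec (Fin M) n) {τ} → All (InC d) c →
                   dot c (toNatVec x) ≡ τ → c ≢ replicate n (+ 0) →
                   x ∈ cover n (countEq (+ 0) c) τ
  cover-complete [] [] _ _ c≢0 = ⊥-elim (c≢0 refl)
  cover-complete {suc n} (c₀ ∷ cs) (x₀ ∷ xs) {τ} (c₀∈C ∷ cs∈C) c·x≡τ c≢0 with c₀ ℤ.≟ + 0
  ... | yes refl = ∈-++⁺ˡ (∈-branch _ (∈-allFin x₀)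
          (cover-complete cs xs cs∈C (trans (sym (ℤ.+-identityˡ _)) c·x≡τ) (c≢0 ∘ cong (+ 0 ∷_))))
  ... | no c₀≢0 = ∈-++⁺ʳ (leadingZero n (countEq (+ 0) cs) τ)
          (∈-concat⁺′ (tail-case (Vec.≡-dec ℤ._≟_ cs (replicate _ (+ 0))))
                      (∈-map⁺ _ (∈-nonzeroCoeffs d c₀∈C c₀≢0)))
    where
    c₀x₀ : ℤ
    c₀x₀ = c₀ ℤ.* + toℕ x₀
    tail-case : Dec (cs ≡ replicate n (+ 0)) → (x₀ ∷ xs) ∈ leadingNonzero n (countEq (+ 0) cs) τ c₀
    tail-case (no cs≢0) = ∈-++⁺ˡ (∈-branch _ (∈-allFin x₀)
      (cover-complete cs xs cs∈C (trans (sym (xyx⁻¹≈y c₀x₀ _)) (cong (_- c₀x₀) c·x≡τ)) cs≢0))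
    tail-case (yes refl) = ∈-++⁺ʳ _ (∈-soleNonzero xs (countEq-replicate n) (∈-roots x₀ c₀≢0 (begin
      c₀x₀                                          ≡⟨ ℤ.+-identityʳ c₀x₀ ⟨
      c₀x₀ ℤ.+ + 0                                  ≡⟨ cong (λ t → c₀x₀ ℤ.+ t) (dot-replicate (toNatVec xs)) ⟨
      c₀x₀ ℤ.+ dot (replicate n (+ 0)) (toNatVec xs) ≡⟨ c·x≡τ ⟩
      τ                                             ∎)))
      where open ≡-Reasoning

  length-branch-allFin : ∀ {n} (f : Fin M → List (Vec (Fin M) n)) {k} →
                         (∀ x → length (f x) ≤ k) → length (branch f (allFin M)) ≤ M * k
  length-branch-allFin f {k} bound =
    ≤-trans (length-branch f (allFin M) bound) (≤-reflexive (cong (_* k) (length-tabulate {n = M} id)))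

  length-allVecs : ∀ n → length (allVecs n) ≤ M ^ n
  length-allVecs zero = ≤-refl
  length-allVecs (suc n) = length-branch-allFin _ (λ _ → length-allVecs n)

  length-fromℕ? : ∀ y → length (fromℕ? y) ≤ 1
  length-fromℕ? y with y <? M
  ... | yes _ = ≤-refl
  ... | no _ = z≤n

  length-roots : ∀ c τ → length (roots c τ) ≤ 1
  length-roots (+ zero) τ = z≤n
  length-roots (+ suc _) τ = length-fromℕ? _
  length-roots -[1+ _ ] τ = length-fromℕ? _

  open CoverSize M (2 * d) public

  length-soleNonzero : ∀ n K τ c₀ → length (soleNonzero n K τ c₀) ≤ soleNonzeroSize n K
  length-soleNonzero n K τ c₀ with K ≟ n
  ... | yes _ = begin
    length (branch (λ _ → allVecs n) (roots c₀ τ)) ≤⟨ length-branch _ (roots c₀ τ) (λ _ → length-allVecs n) ⟩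
    length (roots c₀ τ) * M ^ n                    ≤⟨ *-monoˡ-≤ (M ^ n) (length-roots c₀ τ) ⟩
    1 * M ^ n                                      ≡⟨ *-identityˡ (M ^ n) ⟩
    M ^ n                                          ∎
    where open ≤-Reasoning
  ... | no _ = z≤n

  mutual
    length-cover : ∀ n K τ → length (cover n K τ) ≤ coverSize n K
    length-cover zero K τ = z≤n
    length-cover (suc n) K τ = begin
      length (leadingZero n K τ ++ concatMap (leadingNonzero n K τ) (nonzeroCoeffs d))
        ≡⟨ length-++ (leadingZero n K τ) ⟩
      length (leadingZero n K τ) + length (concatMap (leadingNonzero n K τ) (nonzeroCoeffs d))
        ≤⟨ +-mono-≤ (length-leadingZero n K τ)
                    (length-concatMap-≤ _ (nonzeroCoeffs d) (length-leadingNonzero n K τ)) ⟩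
      leadingZeroSize n K + length (nonzeroCoeffs d) * (M * coverSize n K + soleNonzeroSize n K)
        ≡⟨ cong (λ D → leadingZeroSize n K + D * (M * coverSize n K + soleNonzeroSize n K))
                (length-nonzeroCoeffs d) ⟩
      coverSize (suc n) K ∎
      where open ≤-Reasoning

    length-leadingZero : ∀ n K τ → length (leadingZero n K τ) ≤ leadingZeroSize n K
    length-leadingZero n zero τ = z≤n
    length-leadingZero n (suc K) τ = length-branch-allFin _ (λ _ → length-cover n K τ)

    length-leadingNonzero : ∀ n K τ c₀ →
      length (leadingNonzero n K τ c₀) ≤ M * coverSize n K + soleNonzeroSize n K
    length-leadingNonzero n K τ c₀ =
      ≤-trans (≤-reflexive (length-++ (branch _ (allFin M))))
              (+-mono-≤ (length-branch-allFin _ (λ x₀ → length-cover n K (τ - c₀ ℤ.* + toℕ x₀)))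
                        (length-soleNonzero n K τ c₀))

  hasSolution⇒∈-cover : ∀ {n π τ} (x : Vec (Fin M) n) →
                        HasSolution d π τ (toNatVec x) → x ∈ cover n (π (+ 0)) τ
  hasSolution⇒∈-cover {n} {π} {τ} x (c , c∈Cⁿ , c·x≡τ , counts , τ≡0⇒c≢0) =
    subst (λ K → x ∈ cover n K τ) (counts (+ 0) z≤n) (cover-complete c x c∈Cⁿ c·x≡τ c≢0)
    where
    c≢0 : c ≢ replicate n (+ 0)
    c≢0 c≡0 with τ ℤ.≟ + 0
    ... | yes τ≡0 = τ≡0⇒c≢0 τ≡0 c≡0
    ... | no τ≢0 = τ≢0 (trans (sym c·x≡τ) (trans (cong (λ c → dot c (toNatVec x)) c≡0) (dot-replicate (toNatVec x))))

module Parameters (d p q : ℕ) (d≥1 : 1 ≤ d) (p>0 : 0 < p) (pc<q : p * card d < q) where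

  c D R m s V U u v P α : ℕ
  c = card d
  D = 2 * d
  R = q * c
  m = q + p * c
  s = suc (R * R)
  V = R + s
  U = suc V
  u = U ^ R
  v = V ^ R
  P = u + D * v
  α = U ^ m * V ^ (R ∸ m)

  m≤R : m ≤ R
  m≤R = begin
    q + p * c  ≤⟨ +-monoʳ-≤ q (<⇒≤ pc<q) ⟩
    q + q      ≤⟨ +-monoʳ-≤ q (m≤m*n q D) ⟩
    q + q * D  ≡⟨ *-suc q D ⟨
    R          ∎
    where
    open ≤-Reasoning
    instance
      D≢0 : NonZero D
      D≢0 = >-nonZero (≤-trans d≥1 (m≤m+n d (d + 0)))

  R<cm : R < c * m
  R<cm = begin-strict
    q * c              <⟨ m<m+n (q * c) (*-mono-≤ (*-mono-≤ p>0 (s≤s z≤n)) (s≤s z≤n)) ⟩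
    q * c + p * c * c  ≡⟨ e q p c ⟩
    c * (q + p * c)    ∎
    where
    open ≤-Reasoning
    e : ∀ q p c → q * c + p * c * c ≡ c * (q + p * c)
    e = solve-∀

  P<cα : P < c * α
  P<cα = mixedPower-dominates D R m s m≤R R<cm ≤-refl

  P>0 : 0 < P
  P>0 = ≤-trans (m^n>0 U R) (m≤m+n u (D * v))

  open DecayRate c P α (s≤s z≤n) P>0 P<cα public

  cover-count : ∀ M n K τ → m * n ≤ K * R →
                M * length (Cover.cover d M n K τ) * α ^ n ≤ P ^ n * M ^ n
  cover-count M n K τ mn≤KR with K ≤? n
  ... | no K≰n = begin
    M * length (cover n K τ) * α ^ n  ≤⟨ *-monoˡ-≤ (α ^ n) (*-monoʳ-≤ M (length-cover n K τ)) ⟩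
    M * coverSize n K * α ^ n         ≡⟨ cong (λ x → M * x * α ^ n) (coverSize-vanishes (<⇒≤ (≰⇒> K≰n))) ⟩
    M * 0 * α ^ n                     ≡⟨ cong (_* α ^ n) (*-zeroʳ M) ⟩
    0                                 ≤⟨ z≤n ⟩
    P ^ n * M ^ n                     ∎
    where
    open ≤-Reasoning
    open Cover d M
  ... | yes K≤n = begin
    M * length (cover n K τ) * α ^ n                  ≤⟨ *-mono-≤ (*-monoʳ-≤ M (length-cover n K τ))
                                                                  (mixedPower-^-≤ U V R m n K (n≤1+n V) m≤R K≤n mn≤KR) ⟩
    M * coverSize n K * weight n K                    ≤⟨ m≤m+n _ (zeroTerm n) ⟩
    M * coverSize n K * weight n K + zeroTerm n       ≤⟨ coverSize-weighted n K ⟩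
    P ^ n * M ^ n                                     ∎
    where
    open ≤-Reasoning
    open Cover d M
    open Weighted u v

  solutions-rare : ∀ τ n M → c ^ ((E ∸ 1) * n) ≤ M ^ E → (π : ℤ → ℕ) → m * n ≤ π (+ 0) * R →
    Σ (List (Vec (Fin M) n)) λ L →
      ((x : Vec (Fin M) n) → HasSolution d π τ (toNatVec x) → x ∈ L)
      × b ^ n * length L ≤ a ^ n * M ^ n
  solutions-rare τ n M cᴱ⁻¹ⁿ≤Mᴱ π mn≤π₀R =
    cover n (π (+ 0)) τ , hasSolution⇒∈-cover ,
    decay M n _ cᴱ⁻¹ⁿ≤Mᴱ (cover-count M n (π (+ 0)) τ mn≤π₀R)
    where open Cover d M

mainTheorem9 : (d : ℕ) → 1 ≤ d → (τ : ℤ) →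
    ∃ λ (a₀ : ℕ) → ∃ λ (b₀ : ℕ) → 0 < a₀ × 0 < b₀ ×
    ((p q : ℕ) → 0 < p → 0 < q → p * b₀ < a₀ * q →
      ∃ λ (e₁ : ℕ) → ∃ λ (e₂ : ℕ) → 0 < e₁ × 0 < e₂ ×
      ∃ λ (a : ℕ) → ∃ λ (b : ℕ) → a < b ×
      ∃ λ (n₀ : ℕ) →
      ((n M : ℕ) → n₀ ≤ n →
        card d ^ ((e₂ ∸ e₁) * n) ≤ M ^ e₂ →
        M ^ e₂ ≤ card d ^ ((e₂ + e₁) * n) →
        (π : ℤ → ℕ) → IsProfile d n π →
        (q + p * card d) * n ≤ π (+ 0) * (q * card d) →
        Σ (List (Vec (Fin M) n)) λ L →
          ((x : Vec (Fin M) n) → HasSolution d π τ (toNatVec x) → x ∈ L)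
          × b ^ n * length L ≤ a ^ n * M ^ n))
-- δ₀ = 1/|C| keeps m ≤ R, and ε = 1/E.
mainTheorem9 d d≥1 τ = 1 , card d , s≤s z≤n , s≤s z≤n , λ p q p>0 _ pc<1*q →
  let open Parameters d p q d≥1 p>0 (subst (p * card d <_) (*-identityˡ q) pc<1*q) in
  1 , E , s≤s z≤n , E>0 , a , b , n<1+n a , 0 ,
  λ n M _ lower _ π _ π₀-large → solutions-rare τ n M lower π π₀-large
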